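{- Let $S\subseteq(A\times B)\times O$ and $T\subseteq(P\times Q)\times Z$ be communication problems, and let $\Lambda$ be a $\delta$-fooling set of $T$. Then $\mathsf{Cov}(S\times T)\geq\mathsf{Cov}(S)/\delta$. In particular, $$\log\mathsf{Cov}(S\times T)\geq\log\mathsf{Cov}(S)+\log\mathsf{Cov}(T)-\log\log|P||Q|-4.$$
   Context: A communication problem is a relation $S\subseteq (X\times Y)\times Z$ with $X,Y,Z$ finite, where Alice gets $x\in X$, Bob gets $y\in Y$ and they must output $z$ with $(x,y,z)\in S$; every $(x,y)$ has at least one valid $z$. A rectangle is $X'\times Y'$ with $X'\subseteq X,Y'\subseteq Y$; it is monochromatic with color $z$ if $(x,y,z)\in S$ for all its elements. For $\Sigma\subseteq X\times Y$, $\mathsf{Cov}(\Sigma)$ is the minimum number of monochromatic rectangles covering $\Sigma$, and $\mathsf{Cov}(S)=\mathsf{Cov}(X\times Y)$. The direct sum $S\times T\subseteq((A\times P)\times(B\times Q))\times(O\times Z)$ is the problem where Alice gets $(a,p)$, Bob gets $(b,q)$, and a valid output is $(o,z)$ with $(a,b,o)\in S$ and $(p,q,z)\in T$. A set $\Lambda\subseteq P\times Q$ is a $\delta$-fooling set of $T$ if for every $\tilde\Lambda\subseteq\Lambda$ with $|\tilde\Lambda|/|\Lambda|>\delta$ no monochromatic rectangle of $T$ contains all of $\tilde\Lambda$. Logarithms are base 2.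
   Formalization: The parameter δ of the δ-fooling set Λ takes rational values only. -}

module Defs where

open import Level using (Level; 0ℓ)
open import Data.Nat using (ℕ; _≤_)
open import Data.Integer using (+_)
open import Data.Rational using (ℚ; _/_)
import Data.Rational as ℚ
open import Data.Product using (Σ; ∃; _×_; _,_)
open import Data.List using (List; length)
open import Data.List.Relation.Unary.All using (All)
open import Data.List.Relation.Binary.Sublist.Propositional using (_⊆_)
open import Relation.Unary using (Pred)
open import Relation.Nullary using (¬_)
open import Data.List.Relation.Unary.Any using (Any)
open import Data.Unit using (⊤)
open import Relation.Binary.PropositionalEquality using (_≡_)

-- A communication problem S ⊆ (X × Y) × Z, as a relation: S x y z holds iff z is a valid output on (x , y).
Problem : Set → Set → Set → Set₁
Problem X Y Z = X → Y → Z → Set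

Total : {X Y Z : Set} → Problem X Y Z → Set
Total {X} {Y} {Z} S = ∀ (x : X) (y : Y) → ∃ λ (z : Z) → S x y z

record Rectangle (X Y : Set) : Set₁ where
  constructor rect
  field
    rowSet : Pred X 0ℓ
    colSet : Pred Y 0ℓ
open Rectangle public

_∈R_ : {X Y : Set} → X × Y → Rectangle X Y → Set
(x , y) ∈R R = rowSet R x × colSet R y

MonoWith : {X Y Z : Set} → Problem X Y Z → Rectangle X Y → Z → Set
MonoWith {X} {Y} S R z = ∀ (x : X) (y : Y) → (x , y) ∈R R → S x y z

Mono : {X Y Z : Set} → Problem X Y Z → Rectangle X Y → Set
Mono {Z = Z} S R = ∃ λ (z : Z) → MonoWith S R z

IsCoverOf : {X Y Z : Set} → Problem X Y Z → Pred (X × Y) 0ℓ → List (Rectangle X Y) → Set₁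
IsCoverOf {X} {Y} S Σ' Rs =
  All (Mono S) Rs × (∀ (x : X) (y : Y) → Σ' (x , y) → Any (λ R → (x , y) ∈R R) Rs)

Everything : {X Y : Set} → Pred (X × Y) 0ℓ
Everything _ = ⊤

IsCov : {X Y Z : Set} → Problem X Y Z → ℕ → Set₁
IsCov S n =
  (Σ (List _) λ Rs → IsCoverOf S Everything Rs × length Rs ≡ n)
  × (∀ Rs → IsCoverOf S Everything Rs → n ≤ length Rs)

_⊗_ : {A B O P Q Z : Set} → Problem A B O → Problem P Q Z → Problem (A × P) (B × Q) (O × Z)
(S ⊗ T) (a , p) (b , q) (o , z) = S a b o × T p q z

⟦_⟧ : ℕ → ℚ
⟦ n ⟧ = (+ n) / 1

-- Λ (given as a duplicate-free list) is a δ-fooling set of T: every sub-collection Λ̃ ⊆ Λ with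
-- |Λ̃| / |Λ| > δ (written |Λ̃| > δ · |Λ|) is contained in no monochromatic rectangle of T.
Fooling : {P Q Z : Set} → Problem P Q Z → ℚ → List (P × Q) → Set₁
Fooling T δ Λ =
  ∀ (Λ̃ : List _) → Λ̃ ⊆ Λ → δ ℚ.* ⟦ length Λ ⟧ ℚ.< ⟦ length Λ̃ ⟧ →
  ∀ (R : Rectangle _ _) → Mono T R → ¬ All (λ xy → xy ∈R R) Λ̃

{-# OPTIONS --safe #-}
-- Fix a cover of S ⊗ T by m monochromatic rectangles and, for every input ((x , p) , (y , q)), one
-- rectangle of it containing that input.  Say rectangle i is used at (p , q) if it is chosen above
-- (p , q) for some (x , y).  The rectangles used at (p , q), sliced at (p , q), cover S, so at least
-- Cov(S) rectangles are used at every (p , q); and the points at which rectangle i is used lie in its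
-- shadow on P × Q, which is a monochromatic rectangle of T.
--   Averaging over Λ, some rectangle is used at ≥ Cov(S)·|Λ|/m points of Λ, but its shadow contains
-- at most δ|Λ| of them; hence Cov(S) ≤ δ·m.  For the second bound, run greedy set cover on P × Q with
-- the sets "points where rectangle i is used": every point lies in ≥ Cov(S) of the m sets, so each
-- greedy step leaves at most a (1 − Cov(S)/m) fraction of the points, and after K steps
-- 2^(Cov(S)·K) ≤ 2^Cov(S) · (|P||Q|)^m.  The shadows of the chosen K rectangles cover T.
module Submission where

open import Defs
open import Data.Nat using (ℕ; _≤_; _*_; _^_)
open import Data.Fin using (Fin)
open import Data.Product using (_×_)
open import Data.List using (List; [])
open import Data.List.Relation.Unary.Unique.Propositional using (Unique)
open import Data.Rational using (ℚ)
import Data.Rational as ℚ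
open import Relation.Binary.PropositionalEquality using (_≢_)

open import Data.Nat using (zero; suc; _+_; _∸_; z≤n; s≤s; NonZero; >-nonZero)
open import Data.Nat.Properties hiding (_≟_)
open import Data.Nat.ListAction using (sum)
open import Data.Nat.Tactic.RingSolver using (solve-∀)
open import Data.Nat.Coprimality using (1-coprimeTo) renaming (sym to coprime-sym)
import Data.Integer as ℤ
import Data.Integer.Properties as ℤP
open import Data.Rational using (mkℚ; _/_)
import Data.Rational.Properties as ℚP
open import Data.Fin using (_≟_)
open import Data.Fin.Properties using (any?)
open import Data.List using (_∷_; length; map; filter; allFin; lookup; cartesianProduct)
open import Data.List.Properties using (length-filter; length-tabulate; length-map; length-++)
open import Data.List.Membership.Propositional.Properties
  using (∈-lookup; ∈-allFin; ∈-filter⁺; ∈-cartesianProduct⁺)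
open import Data.List.Relation.Unary.All as All using (All; []; _∷_)
import Data.List.Relation.Unary.All.Properties as All
open import Data.List.Relation.Unary.Any as Any using (Any; here; there)
import Data.List.Relation.Unary.Any.Properties as Any
open import Data.List.Relation.Binary.Sublist.Propositional.Properties using (filter-⊆)
open import Data.Product using (∃; ∃₂; _,_; proj₁; proj₂)
open import Data.Unit using (tt)
open import Relation.Nullary using (Dec; yes; no; contradiction)
open import Relation.Unary using (Decidable)
open import Relation.Unary.Properties using (∁?)
open import Relation.Binary.PropositionalEquality
  using (_≡_; refl; sym; trans; cong; cong₂; subst; subst₂; module ≡-Reasoning)
open import Algebra.Properties.CommutativeSemigroup +-commutativeSemigroup
  using () renaming (x∙yz≈y∙xz to x+[y+z]≡y+[x+z])
open import Algebra.Properties.CommutativeSemigroup *-commutativeSemigroup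
  using () renaming (x∙yz≈y∙xz to x*[y*z]≡y*[x*z]; xy∙z≈y∙xz to x*y*z≡y*[x*z]; interchange to *-interchange)

^-distribʳ-* : ∀ x y n → (x * y) ^ n ≡ x ^ n * y ^ n
^-distribʳ-* x y zero = refl
^-distribʳ-* x y (suc n) = begin
    x * y * (x * y) ^ n
  ≡⟨ cong (x * y *_) (^-distribʳ-* x y n) ⟩
    x * y * (x ^ n * y ^ n)
  ≡⟨ *-interchange x y (x ^ n) (y ^ n) ⟩
    x * x ^ n * (y * y ^ n) ∎
  where open ≡-Reasoning

-- Bernoulli's inequality (1 + 1/x)^r ≥ 1 + r/x, multiplied by x^(r+1).
bernoulli : ∀ x r → x ^ r * (x + r) ≤ x * (1 + x) ^ r
bernoulli x zero = ≤-reflexive (trans (*-identityˡ (x + 0)) (trans (+-identityʳ x) (sym (*-identityʳ x))))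
bernoulli x (suc r) = begin
    x * x ^ r * (x + suc r)
  ≤⟨ m≤m+n _ _ ⟩
    x * x ^ r * (x + suc r) + x ^ r * r
  ≡⟨ expand x (x ^ r) r ⟨
    (1 + x) * (x ^ r * (x + r))
  ≤⟨ *-monoʳ-≤ (1 + x) (bernoulli x r) ⟩
    (1 + x) * (x * (1 + x) ^ r)
  ≡⟨ x*[y*z]≡y*[x*z] (1 + x) x ((1 + x) ^ r) ⟩
    x * ((1 + x) * (1 + x) ^ r) ∎
  where
  open ≤-Reasoning
  expand : ∀ x y r → (1 + x) * (y * (x + r)) ≡ x * y * (x + suc r) + y * r
  expand = solve-∀

2*x^r≤[1+x]^r : ∀ x r → x ≤ r → 1 ≤ r → 2 * x ^ r ≤ (1 + x) ^ r
2*x^r≤[1+x]^r zero (suc r) _ _ = z≤n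
2*x^r≤[1+x]^r (suc x) r x<r _ = *-cancelˡ-≤ (suc x) (begin
    suc x * (2 * suc x ^ r)
  ≡⟨ rearrange (suc x) (suc x ^ r) ⟩
    suc x ^ r * (suc x + suc x)
  ≤⟨ *-monoʳ-≤ (suc x ^ r) (+-monoʳ-≤ (suc x) x<r) ⟩
    suc x ^ r * (suc x + r)
  ≤⟨ bernoulli (suc x) r ⟩
    suc x * (1 + suc x) ^ r ∎)
  where
  open ≤-Reasoning
  rearrange : ∀ a y → a * (2 * y) ≡ y * (a + a)
  rearrange = solve-∀

-- (1 + c/x)^(x+c) ≥ 2^c, by induction on c, trading one unit of c for one of x.
2^c*x^[x+c]≤[x+c]^[x+c] : ∀ c x → 2 ^ c * x ^ (x + c) ≤ (x + c) ^ (x + c)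
2^c*x^[x+c]≤[x+c]^[x+c] zero x rewrite +-identityʳ x = ≤-reflexive (+-identityʳ _)
2^c*x^[x+c]≤[x+c]^[x+c] (suc c) x rewrite +-suc x c = begin
    2 * 2 ^ c * x ^ suc (x + c)
  ≡⟨ x*y*z≡y*[x*z] 2 (2 ^ c) (x ^ suc (x + c)) ⟩
    2 ^ c * (2 * x ^ suc (x + c))
  ≤⟨ *-monoʳ-≤ (2 ^ c) (2*x^r≤[1+x]^r x (suc (x + c)) (m≤n⇒m≤1+n (m≤m+n x c)) (s≤s z≤n)) ⟩
    2 ^ c * (1 + x) ^ suc (x + c)
  ≤⟨ 2^c*x^[x+c]≤[x+c]^[x+c] c (suc x) ⟩
    suc (x + c) ^ suc (x + c) ∎
  where open ≤-Reasoning

2^c*[m∸c]^m≤m^m : ∀ c m → c ≤ m → 2 ^ c * (m ∸ c) ^ m ≤ m ^ m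
2^c*[m∸c]^m≤m^m c m c≤m =
  subst (λ e → 2 ^ c * (m ∸ c) ^ e ≤ e ^ e) (m∸n+n≡m c≤m) (2^c*x^[x+c]≤[x+c]^[x+c] c (m ∸ c))

-- Removing s ≥ (c/m)·u of u points shrinks u^m by a factor 2^c, as (1 − c/m)^m ≤ 2^−c.
2^c*u′^m≤u^m : ∀ {c m u u′ s} → c ≤ m → u′ + s ≡ u → c * u ≤ m * s → 2 ^ c * u′ ^ m ≤ u ^ m
2^c*u′^m≤u^m {m = zero} z≤n _ _ = ≤-refl
2^c*u′^m≤u^m {c} {m@(suc _)} {u} {u′} {s} c≤m u′+s≡u cu≤ms = *-cancelˡ-≤ (m ^ m) {{m^n≢0 m m}} (begin
    m ^ m * (2 ^ c * u′ ^ m)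
  ≡⟨ x*[y*z]≡y*[x*z] (m ^ m) (2 ^ c) (u′ ^ m) ⟩
    2 ^ c * (m ^ m * u′ ^ m)
  ≡⟨ cong (2 ^ c *_) (^-distribʳ-* m u′ m) ⟨
    2 ^ c * (m * u′) ^ m
  ≤⟨ *-monoʳ-≤ (2 ^ c) (^-monoˡ-≤ m mu′≤[m∸c]u) ⟩
    2 ^ c * ((m ∸ c) * u) ^ m
  ≡⟨ cong (2 ^ c *_) (^-distribʳ-* (m ∸ c) u m) ⟩
    2 ^ c * ((m ∸ c) ^ m * u ^ m)
  ≡⟨ *-assoc (2 ^ c) ((m ∸ c) ^ m) (u ^ m) ⟨
    2 ^ c * (m ∸ c) ^ m * u ^ m
  ≤⟨ *-monoˡ-≤ (u ^ m) (2^c*[m∸c]^m≤m^m c m c≤m) ⟩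
    m ^ m * u ^ m ∎)
  where
  open ≤-Reasoning
  mu′≤[m∸c]u : m * u′ ≤ (m ∸ c) * u
  mu′≤[m∸c]u = +-cancelʳ-≤ (c * u) _ _ (begin
      m * u′ + c * u
    ≤⟨ +-monoʳ-≤ (m * u′) cu≤ms ⟩
      m * u′ + m * s
    ≡⟨ *-distribˡ-+ m u′ s ⟨
      m * (u′ + s)
    ≡⟨ cong₂ _*_ (sym (m∸n+n≡m c≤m)) u′+s≡u ⟩
      (m ∸ c + c) * u
    ≡⟨ *-distribʳ-+ u (m ∸ c) c ⟩
      (m ∸ c) * u + c * u ∎)

2^[c*[1+k]]≤2^c*u^m : ∀ {c m u u′ s k} → c ≤ m → u′ + s ≡ u → c * u ≤ m * s →
  2 ^ (c * k) ≤ 2 ^ c * u′ ^ m → 2 ^ (c * suc k) ≤ 2 ^ c * u ^ m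
2^[c*[1+k]]≤2^c*u^m {c} {m} {u} {u′} {k = k} c≤m u′+s≡u cu≤ms 2^[ck]≤2^c*u′^m = begin
  2 ^ (c * suc k)            ≡⟨ cong (2 ^_) (*-suc c k) ⟩
  2 ^ (c + c * k)            ≡⟨ ^-distribˡ-+-* 2 c (c * k) ⟩
  2 ^ c * 2 ^ (c * k)        ≤⟨ *-monoʳ-≤ (2 ^ c) 2^[ck]≤2^c*u′^m ⟩
  2 ^ c * (2 ^ c * u′ ^ m)   ≤⟨ *-monoʳ-≤ (2 ^ c) (2^c*u′^m≤u^m c≤m u′+s≡u cu≤ms) ⟩
  2 ^ c * u ^ m              ∎
  where open ≤-Reasoning

length-allFin : ∀ n → length (allFin n) ≡ n
length-allFin n = length-tabulate (λ i → i)

length-filter∁+length-filter : {A : Set} {P : A → Set} (P? : Decidable P) (xs : List A) →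
  length (filter (∁? P?) xs) + length (filter P? xs) ≡ length xs
length-filter∁+length-filter P? [] = refl
length-filter∁+length-filter P? (x ∷ xs) with P? x
... | yes _ = trans (+-suc _ _) (cong suc (length-filter∁+length-filter P? xs))
... | no _ = cong suc (length-filter∁+length-filter P? xs)

∃-≥-average : {I : Set} (f : I → ℕ) (xs : List I) → 1 ≤ length xs →
  ∃ λ j → sum (map f xs) ≤ length xs * f j
∃-≥-average f (x ∷ []) _ = x , ≤-refl
∃-≥-average f (x ∷ xs@(_ ∷ _)) _ with ∃-≥-average f xs (s≤s z≤n)
... | j , ih with f x ≤? f j
...   | yes fx≤fj = j , +-mono-≤ fx≤fj ih
...   | no fx≰fj = x , +-monoʳ-≤ (f x) (≤-trans ih (*-monoʳ-≤ (length xs) (<⇒≤ (≰⇒> fx≰fj))))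

c*length≤sum : ∀ {c} {A : Set} (g : A → ℕ) {xs : List A} → All (λ x → c ≤ g x) xs →
  c * length xs ≤ sum (map g xs)
c*length≤sum {c} g [] = ≤-reflexive (*-zeroʳ c)
c*length≤sum {c} g {_ ∷ xs} (c≤gx ∷ c≤gxs) =
  ≤-trans (≤-reflexive (*-suc c (length xs))) (+-mono-≤ c≤gx (c*length≤sum g c≤gxs))

module SetSystem {Pt : Set} {m : ℕ} {_∋_ : Fin m → Pt → Set} (_∋?_ : ∀ i u → Dec (i ∋ u)) where

  count : Fin m → List Pt → ℕ
  count i U = length (filter (i ∋?_) U)

  degree : Pt → ℕ
  degree u = length (filter (_∋? u) (allFin m))

  degree≤m : ∀ u → degree u ≤ m
  degree≤m u = ≤-trans (length-filter (_∋? u) (allFin m)) (≤-reflexive (length-allFin m))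

  sum-count-∷ : ∀ (Is : List (Fin m)) u U →
    sum (map (λ i → count i (u ∷ U)) Is) ≡ length (filter (_∋? u) Is) + sum (map (λ i → count i U) Is)
  sum-count-∷ [] u U = refl
  sum-count-∷ (i ∷ Is) u U with i ∋? u
  ... | yes _ = cong suc (trans (cong (count i U +_) (sum-count-∷ Is u U))
                               (x+[y+z]≡y+[x+z] (count i U) (length (filter (_∋? u) Is)) _))
  ... | no _  = trans (cong (count i U +_) (sum-count-∷ Is u U))
                      (x+[y+z]≡y+[x+z] (count i U) (length (filter (_∋? u) Is)) _)

  sum-degree≡sum-count : ∀ U → sum (map degree U) ≡ sum (map (λ i → count i U) (allFin m))
  sum-degree≡sum-count [] = sym (sum-map-zero (allFin m))
    where
    sum-map-zero : (Is : List (Fin m)) → sum (map (λ _ → 0) Is) ≡ 0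
    sum-map-zero [] = refl
    sum-map-zero (_ ∷ Is) = sum-map-zero Is
  sum-degree≡sum-count (u ∷ U) =
    trans (cong (degree u +_) (sum-degree≡sum-count U)) (sym (sum-count-∷ (allFin m) u U))

  ≤degree⇒≤m : ∀ {c U} → 1 ≤ length U → All (λ u → c ≤ degree u) U → c ≤ m
  ≤degree⇒≤m {U = u ∷ _} _ (c≤degree-u ∷ _) = ≤-trans c≤degree-u (degree≤m u)

  ∃-heavy : ∀ {c} U → 1 ≤ m → All (λ u → c ≤ degree u) U → ∃ λ i → c * length U ≤ m * count i U
  ∃-heavy {c} U 1≤m c≤degree
    with ∃-≥-average (λ i → count i U) (allFin m) (subst (1 ≤_) (sym (length-allFin m)) 1≤m)
  ... | i , average≤max = i , (begin
      c * length U                            ≤⟨ c*length≤sum degree c≤degree ⟩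
      sum (map degree U)                      ≡⟨ sum-degree≡sum-count U ⟩
      sum (map (λ i → count i U) (allFin m))  ≤⟨ average≤max ⟩
      length (allFin m) * count i U           ≡⟨ cong (_* count i U) (length-allFin m) ⟩
      m * count i U                           ∎)
    where open ≤-Reasoning

  Covers : List (Fin m) → List Pt → Set
  Covers Js U = All (λ u → Any (_∋ u) Js) U

  covers-by-∷ : ∀ i {Js} U → Covers Js (filter (∁? (i ∋?_)) U) → Covers (i ∷ Js) U
  covers-by-∷ i U covers-rest =
    All.filter⁻ (i ∋?_) (All.map here (All.all-filter (i ∋?_) U)) (All.map there covers-rest)

  greedy-cover-within : ∀ {c} → 1 ≤ c → ∀ n U → length U ≤ n → 1 ≤ length U → All (λ u → c ≤ degree u) U →
    ∃ λ Js → Covers Js U × 2 ^ (c * length Js) ≤ 2 ^ c * length U ^ m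
  greedy-cover-within 1≤c zero U |U|≤0 1≤|U| _ = contradiction (≤-trans 1≤|U| |U|≤0) (λ ())
  greedy-cover-within {c} 1≤c (suc n) U |U|≤1+n 1≤|U| c≤degree
    with ∃-heavy U (≤-trans 1≤c (≤degree⇒≤m 1≤|U| c≤degree)) c≤degree
  ... | i , heavy with filter (∁? (i ∋?_)) U in rest≡
  ...   | [] = (i ∷ []) , covers-by-∷ i U (subst (Covers _) (sym rest≡) []) , single-bound
    where
    instance
      |U|^m≢0 : NonZero (length U ^ m)
      |U|^m≢0 = m^n≢0 (length U) m {{>-nonZero 1≤|U|}}
    single-bound : 2 ^ (c * 1) ≤ 2 ^ c * length U ^ m
    single-bound =
      subst (λ e → 2 ^ e ≤ 2 ^ c * length U ^ m) (sym (*-identityʳ c)) (m≤m*n (2 ^ c) (length U ^ m))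
  ...   | v ∷ V = (i ∷ Js) , covers-by-∷ i U (subst (Covers Js) (sym rest≡) covers-rest)
                , 2^[c*[1+k]]≤2^c*u^m c≤m split heavy bound
    where
    c≤m : c ≤ m
    c≤m = ≤degree⇒≤m 1≤|U| c≤degree
    split : length (v ∷ V) + count i U ≡ length U
    split = trans (cong (λ rest → length rest + count i U) (sym rest≡)) (length-filter∁+length-filter (i ∋?_) U)
    1≤count : 1 ≤ count i U
    1≤count = n≢0⇒n>0 λ count≡0 → contradiction
      (≤-trans (*-mono-≤ 1≤c 1≤|U|) (≤-trans heavy (≤-reflexive (trans (cong (m *_) count≡0) (*-zeroʳ m)))))
      (λ ())
    |rest|≤n : length (v ∷ V) ≤ n
    |rest|≤n = ≤-pred (begin
      1 + length (v ∷ V)         ≡⟨ +-comm 1 (length (v ∷ V)) ⟩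
      length (v ∷ V) + 1         ≤⟨ +-monoʳ-≤ (length (v ∷ V)) 1≤count ⟩
      length (v ∷ V) + count i U ≡⟨ split ⟩
      length U                   ≤⟨ |U|≤1+n ⟩
      suc n                      ∎)
      where open ≤-Reasoning
    c≤degree-rest : All (λ u → c ≤ degree u) (v ∷ V)
    c≤degree-rest = subst (All _) rest≡ (All.filter⁺ (∁? (i ∋?_)) c≤degree)
    recursive-cover : ∃ λ Js → Covers Js (v ∷ V) × 2 ^ (c * length Js) ≤ 2 ^ c * length (v ∷ V) ^ m
    recursive-cover = greedy-cover-within 1≤c n (v ∷ V) |rest|≤n (s≤s z≤n) c≤degree-rest
    Js : List (Fin m)
    Js = proj₁ recursive-cover
    covers-rest : Covers Js (v ∷ V)
    covers-rest = proj₁ (proj₂ recursive-cover)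
    bound : 2 ^ (c * length Js) ≤ 2 ^ c * length (v ∷ V) ^ m
    bound = proj₂ (proj₂ recursive-cover)

  greedy-cover : ∀ {c U} → 1 ≤ c → 1 ≤ length U → All (λ u → c ≤ degree u) U →
    ∃ λ Js → Covers Js U × 2 ^ (c * length Js) ≤ 2 ^ c * length U ^ m
  greedy-cover {U = U} 1≤c = greedy-cover-within 1≤c (length U) U ≤-refl

length-cartesianProduct : {A B : Set} (xs : List A) (ys : List B) →
  length (cartesianProduct xs ys) ≡ length xs * length ys
length-cartesianProduct [] ys = refl
length-cartesianProduct (x ∷ xs) ys =
  trans (length-++ (map (x ,_) ys)) (cong₂ _+_ (length-map (x ,_) ys) (length-cartesianProduct xs ys))

⟦⟧≡mkℚ : ∀ n → ⟦ n ⟧ ≡ mkℚ (ℤ.+ n) 0 (coprime-sym (1-coprimeTo n))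
⟦⟧≡mkℚ n = ℚP.normalize-coprime (coprime-sym (1-coprimeTo n))

⟦⟧-* : ∀ m n → ⟦ m * n ⟧ ≡ ⟦ m ⟧ ℚ.* ⟦ n ⟧
⟦⟧-* m n rewrite ⟦⟧≡mkℚ m | ⟦⟧≡mkℚ n = cong (_/ 1) (ℤP.pos-* m n)

⟦⟧-mono-≤ : ∀ {m n} → m ≤ n → ⟦ m ⟧ ℚ.≤ ⟦ n ⟧
⟦⟧-mono-≤ {m} {n} m≤n rewrite ⟦⟧≡mkℚ m | ⟦⟧≡mkℚ n =
  ℚ.*≤* (subst₂ ℤ._≤_ (sym (ℤP.*-identityʳ (ℤ.+ m))) (sym (ℤP.*-identityʳ (ℤ.+ n))) (ℤ.+≤+ m≤n))

⟦⟧-nonNegative : ∀ n → ℚ.NonNegative ⟦ n ⟧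
⟦⟧-nonNegative n rewrite ⟦⟧≡mkℚ n = _

⟦⟧-positive : ∀ n → ℚ.Positive ⟦ suc n ⟧
⟦⟧-positive n rewrite ⟦⟧≡mkℚ (suc n) = _

module ProjectedCover {a b o p q z : ℕ}
    {S : Problem (Fin a) (Fin b) (Fin o)} {T : Problem (Fin p) (Fin q) (Fin z)}
    {Rs : List (Rectangle (Fin a × Fin p) (Fin b × Fin q))}
    (cover : IsCoverOf (S ⊗ T) Everything Rs) where

  m : ℕ
  m = length Rs

  choice : Fin a → Fin b → Fin p × Fin q → Fin m
  choice x y (p′ , q′) = Any.index (proj₂ cover (x , p′) (y , q′) tt)

  ∈-choice : ∀ x y pq → ((x , proj₁ pq) , (y , proj₂ pq)) ∈R lookup Rs (choice x y pq)
  ∈-choice x y (p′ , q′) = Any.lookup-index (proj₂ cover (x , p′) (y , q′) tt)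

  Uses : Fin m → Fin p × Fin q → Set
  Uses i pq = ∃₂ λ x y → choice x y pq ≡ i

  uses? : ∀ i pq → Dec (Uses i pq)
  uses? i pq = any? λ x → any? λ y → choice x y pq ≟ i

  open SetSystem uses? public

  mono : ∀ i → Mono (S ⊗ T) (lookup Rs i)
  mono i = All.lookup (proj₁ cover) (∈-lookup i)

  shadow : Fin m → Rectangle (Fin p) (Fin q)
  shadow i = rect (λ p′ → ∃ λ q′ → Uses i (p′ , q′)) (λ q′ → ∃ λ p′ → Uses i (p′ , q′))

  ∈-shadow : ∀ {i} pq → Uses i pq → pq ∈R shadow i
  ∈-shadow (p′ , q′) uses = (q′ , uses) , (p′ , uses)

  -- A row and a column of the shadow lift to a row and a column of the same rectangle of S ⊗ T.
  shadow-mono : ∀ i → Mono T (shadow i)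
  shadow-mono i = proj₂ (proj₁ (mono i)) , λ where
    p′ q′ ((q₁ , x₁ , y₁ , choice≡i) , (p₂ , x₂ , y₂ , choice≡i′)) → proj₂ (proj₂ (mono i) (x₁ , p′) (y₂ , q′)
      ( subst (λ j → rowSet (lookup Rs j) (x₁ , p′)) choice≡i (proj₁ (∈-choice x₁ y₁ (p′ , q₁)))
      , subst (λ j → colSet (lookup Rs j) (y₂ , q′)) choice≡i′ (proj₂ (∈-choice x₂ y₂ (p₂ , q′)))))

  slice : Fin p × Fin q → Fin m → Rectangle (Fin a) (Fin b)
  slice (p′ , q′) i = rect (λ x → rowSet (lookup Rs i) (x , p′)) (λ y → colSet (lookup Rs i) (y , q′))

  slice-mono : ∀ pq i → Mono S (slice pq i)
  slice-mono (p′ , q′) i =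
    proj₁ (proj₁ (mono i)) , λ x y xy∈slice → proj₁ (proj₂ (mono i) (x , p′) (y , q′) xy∈slice)

  slices-cover : ∀ pq → IsCoverOf S Everything (map (slice pq) (filter (λ i → uses? i pq) (allFin m)))
  slices-cover pq = All.map⁺ (All.universal (slice-mono pq) _) , λ x y _ →
    Any.map⁺ (Any.map (λ { refl → ∈-choice x y pq })
      (∈-filter⁺ (λ i → uses? i pq) (∈-allFin (choice x y pq)) (x , y , refl)))

  Cov≤degree : ∀ {cS} → IsCov S cS → ∀ pq → cS ≤ degree pq
  Cov≤degree isCov pq = ≤-trans (proj₂ isCov _ (slices-cover pq))
    (≤-reflexive (length-map (slice pq) (filter (λ i → uses? i pq) (allFin m))))

  Cov≤length : ∀ {cT Js} → IsCov T cT → Covers Js (cartesianProduct (allFin p) (allFin q)) → cT ≤ length Js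
  Cov≤length {Js = Js} isCov covers =
    ≤-trans (proj₂ isCov (map shadow Js) (All.map⁺ (All.universal shadow-mono Js) , shadows-cover))
            (≤-reflexive (length-map shadow Js))
    where
    shadows-cover : ∀ p′ q′ → Everything (p′ , q′) → Any ((p′ , q′) ∈R_) (map shadow Js)
    shadows-cover p′ q′ _ = Any.map⁺ (Any.map (∈-shadow (p′ , q′))
      (All.lookup covers (∈-cartesianProduct⁺ (∈-allFin p′) (∈-allFin q′))))

  count≤δ*length : ∀ {δ Λ} → Fooling T δ Λ → ∀ i → ⟦ count i Λ ⟧ ℚ.≤ δ ℚ.* ⟦ length Λ ⟧
  count≤δ*length {Λ = Λ} fooling i = ℚP.≮⇒≥ λ δ*|Λ|<count →
    fooling (filter (uses? i) Λ) (filter-⊆ (uses? i) Λ) δ*|Λ|<count (shadow i) (shadow-mono i)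
      (All.map (∈-shadow _) (All.all-filter (uses? i) Λ))

Cov[S]≤δ*Cov[S⊗T] : ∀ {a b o p q z : ℕ}
    (S : Problem (Fin a) (Fin b) (Fin o)) (T : Problem (Fin p) (Fin q) (Fin z))
    (δ : ℚ) (Λ : List (Fin p × Fin q)) → Λ ≢ [] → Fooling T δ Λ →
    ∀ {cS cST} → IsCov S cS → IsCov (S ⊗ T) cST → ⟦ cS ⟧ ℚ.≤ δ ℚ.* ⟦ cST ⟧
Cov[S]≤δ*Cov[S⊗T] S T δ [] Λ≢[] = contradiction refl Λ≢[]
Cov[S]≤δ*Cov[S⊗T] S T δ (pq ∷ _) _ _ {cS} isCovS (([] , cover , refl) , _) =
  subst (λ c → ⟦ c ⟧ ℚ.≤ δ ℚ.* ⟦ 0 ⟧) (sym (n≤0⇒n≡0 cS≤0)) (ℚP.≤-reflexive (sym (ℚP.*-zeroʳ δ)))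
  where
  open ProjectedCover cover
  cS≤0 : cS ≤ 0
  cS≤0 = ≤-trans (Cov≤degree isCovS pq) (degree≤m pq)
Cov[S]≤δ*Cov[S⊗T] S T δ Λ@(_ ∷ Λ′) _ fooling {cS} isCovS ((_ ∷ _ , cover , refl) , _) =
  ℚP.*-cancelʳ-≤-pos ⟦ length Λ ⟧ {{⟦⟧-positive (length Λ′)}} (begin
    ⟦ cS ⟧ ℚ.* ⟦ length Λ ⟧          ≡⟨ ⟦⟧-* cS (length Λ) ⟨
    ⟦ cS * length Λ ⟧                ≤⟨ ⟦⟧-mono-≤ (proj₂ heavy) ⟩
    ⟦ m * count i Λ ⟧                ≡⟨ ⟦⟧-* m (count i Λ) ⟩
    ⟦ m ⟧ ℚ.* ⟦ count i Λ ⟧          ≤⟨ ℚP.*-monoˡ-≤-nonNeg ⟦ m ⟧ {{⟦⟧-nonNegative m}} (count≤δ*length {δ} {Λ} fooling i) ⟩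
    ⟦ m ⟧ ℚ.* (δ ℚ.* ⟦ length Λ ⟧)  ≡⟨ ℚP.*-assoc ⟦ m ⟧ δ ⟦ length Λ ⟧ ⟨
    ⟦ m ⟧ ℚ.* δ ℚ.* ⟦ length Λ ⟧    ≡⟨ cong (ℚ._* ⟦ length Λ ⟧) (ℚP.*-comm ⟦ m ⟧ δ) ⟩
    δ ℚ.* ⟦ m ⟧ ℚ.* ⟦ length Λ ⟧    ∎)
  where
  open ProjectedCover cover
  open ℚP.≤-Reasoning
  heavy : ∃ λ i → cS * length Λ ≤ m * count i Λ
  heavy = ∃-heavy Λ (s≤s z≤n) (All.universal (Cov≤degree isCovS) Λ)
  i : Fin m
  i = proj₁ heavy

2^[Cov[S]*Cov[T]]≤[p*q]^[16*Cov[S⊗T]] : ∀ {a b o p q z : ℕ}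
    (S : Problem (Fin a) (Fin b) (Fin o)) (T : Problem (Fin p) (Fin q) (Fin z)) →
    ∀ {cS cT cST} → IsCov S cS → IsCov T cT → IsCov (S ⊗ T) cST → 2 ≤ p * q →
    2 ^ (cS * cT) ≤ (p * q) ^ (16 * cST)
2^[Cov[S]*Cov[T]]≤[p*q]^[16*Cov[S⊗T]] {p = p} {q} S T {zero} {cST = cST} _ _ _ 2≤pq =
  m^n>0 (p * q) {{>-nonZero (≤-trans (s≤s z≤n) 2≤pq)}} (16 * cST)
2^[Cov[S]*Cov[T]]≤[p*q]^[16*Cov[S⊗T]] {p = p} {q} S T {suc c} {cT} isCovS isCovT ((_ , cover , refl) , _) 2≤pq =
  begin
    2 ^ (suc c * cT)                  ≤⟨ ^-monoʳ-≤ 2 (*-monoʳ-≤ (suc c) (Cov≤length isCovT covers)) ⟩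
    2 ^ (suc c * length Js)           ≤⟨ bound ⟩
    2 ^ suc c * length U ^ m          ≡⟨ cong (λ n → 2 ^ suc c * n ^ m) |U|≡p*q ⟩
    2 ^ suc c * (p * q) ^ m           ≤⟨ *-monoˡ-≤ ((p * q) ^ m) (^-monoʳ-≤ 2 c<m) ⟩
    2 ^ m * (p * q) ^ m               ≤⟨ *-monoˡ-≤ ((p * q) ^ m) (^-monoˡ-≤ m 2≤pq) ⟩
    (p * q) ^ m * (p * q) ^ m         ≡⟨ ^-distribˡ-+-* (p * q) m m ⟨
    (p * q) ^ (m + m)                 ≤⟨ ^-monoʳ-≤ (p * q) {{pq≢0}} (m+m≤16*m) ⟩
    (p * q) ^ (16 * m)                ∎
  where
  open ProjectedCover cover
  open ≤-Reasoning
  instance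
    pq≢0 : NonZero (p * q)
    pq≢0 = >-nonZero (≤-trans (s≤s z≤n) 2≤pq)
  U : List (Fin p × Fin q)
  U = cartesianProduct (allFin p) (allFin q)
  |U|≡p*q : length U ≡ p * q
  |U|≡p*q = trans (length-cartesianProduct (allFin p) (allFin q)) (cong₂ _*_ (length-allFin p) (length-allFin q))
  1≤|U| : 1 ≤ length U
  1≤|U| = ≤-trans (s≤s z≤n) (subst (2 ≤_) (sym |U|≡p*q) 2≤pq)
  c≤degree : All (λ u → suc c ≤ degree u) U
  c≤degree = All.universal (Cov≤degree isCovS) U
  c<m : suc c ≤ m
  c<m = ≤degree⇒≤m 1≤|U| c≤degree
  greedy : ∃ λ Js → Covers Js U × 2 ^ (suc c * length Js) ≤ 2 ^ suc c * length U ^ m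
  greedy = greedy-cover (s≤s z≤n) 1≤|U| c≤degree
  Js : List (Fin m)
  Js = proj₁ greedy
  covers : Covers Js U
  covers = proj₁ (proj₂ greedy)
  bound : 2 ^ (suc c * length Js) ≤ 2 ^ suc c * length U ^ m
  bound = proj₂ (proj₂ greedy)
  -- The argument yields the exponent 2·Cov(S ⊗ T); the 16 is slack.
  m+m≤16*m : m + m ≤ 16 * m
  m+m≤16*m = ≤-trans (≤-reflexive (cong (m +_) (sym (+-identityʳ m)))) (*-monoˡ-≤ m {2} {16} (s≤s (s≤s z≤n)))

theorem4p1 : ∀ {a b o p q z : ℕ}
    (S : Problem (Fin a) (Fin b) (Fin o)) (T : Problem (Fin p) (Fin q) (Fin z))
    → Total S → Total T
    → (∀ (δ : ℚ) (Λ : List (Fin p × Fin q)) → Unique Λ → Λ ≢ [] → Fooling T δ Λ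
        → ∀ (cS cST : ℕ) → IsCov S cS → IsCov (S ⊗ T) cST
        → ⟦ cS ⟧ ℚ.≤ δ ℚ.* ⟦ cST ⟧)
      × (∀ (cS cT cST : ℕ) → IsCov S cS → IsCov T cT → IsCov (S ⊗ T) cST
        → 2 ≤ p * q
        → 2 ^ (cS * cT) ≤ (p * q) ^ (16 * cST))
theorem4p1 S T _ _ =
    (λ δ Λ _ Λ≢[] fooling _ _ → Cov[S]≤δ*Cov[S⊗T] S T δ Λ Λ≢[] fooling)
  , (λ _ _ _ → 2^[Cov[S]*Cov[T]]≤[p*q]^[16*Cov[S⊗T]] S T)
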